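{- For positive integers $n,k$ with $k\ge n$ we have $2F(n,k)\ge F(n,k+1)$, and the inequality is strict for $k\ge2n$.
   Context: For positive integers $n,k$, $F(n,k)$ is defined by: $F(n,k)=0$ if $1\le k<n$; $F(n,k)=1$ if $k=n$; and $F(n,k)=\sum_{j=1}^nF(n,k-j)$ if $k>n$. -}

module Defs where

open import Data.Nat using (ℕ; zero; suc; _+_; _∸_; _<ᵇ_; _≡ᵇ_)
open import Data.Bool using (if_then_else_)

sumFrom1 : ℕ → (ℕ → ℕ) → ℕ
sumFrom1 zero    f = 0
sumFrom1 (suc n) f = sumFrom1 n f + f (suc n)

-- Fuel-driven version of the recurrence; each recursive call is on k ∸ j < k,
-- so fuel k suffices for arguments k ≥ 1 (k ∸ j ≥ 1 whenever k > n ≥ j).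
Ffuel : ℕ → ℕ → ℕ → ℕ
Ffuel zero       n k = 0
Ffuel (suc fuel) n k =
  if k <ᵇ n then 0
  else if k ≡ᵇ n then 1
  else sumFrom1 n (λ j → Ffuel fuel n (k ∸ j))

-- F(n,k): 0 if 1 ≤ k < n; 1 if k = n; Σ_{j=1}^n F(n,k-j) if k > n.
-- (Only meaningful for positive n, k.)
F : ℕ → ℕ → ℕ
F n k = Ffuel k n k

-- For k > n the two sums F(n,k+1) = Σ_{j=0}^{n-1} F(n,k-j) and F(n,k) = Σ_{j=1}^{n} F(n,k-j)
-- share the terms with 1 ≤ j ≤ n-1, so F(n,k+1) = F(n,k) + S and F(n,k) = S + F(n,k-n).
-- Hence F(n,k+1) ≤ 2 F(n,k), with the defect F(n,k-n) positive as soon as k - n ≥ n.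
-- At k = n the shared terms all vanish and F(n,n+1) = F(n,n) = 1.
module Submission where

open import Defs
open import Data.Nat using (ℕ; suc; _≤_; _<_; _*_; _+_)
open import Data.Product using (_×_)

open import Data.Nat using (zero; _∸_; _<ᵇ_; _≡ᵇ_; z≤n; s≤s; _≤′_; ≤′-refl; ≤′-step)
open import Data.Nat.Properties
open import Data.Bool using (true; false)
open import Data.Bool.Properties using (T-≡; ¬-not)
open import Data.Product using (_,_)
open import Data.Sum using (inj₁; inj₂)
open import Function.Bundles using (Equivalence)
open import Relation.Binary using (tri<; tri≈; tri>)
open import Relation.Binary.PropositionalEquality

open Equivalence using (to; from)

sumFrom1-cong : ∀ n {f g : ℕ → ℕ} → (∀ j → 1 ≤ j → j ≤ n → f j ≡ g j) →
                sumFrom1 n f ≡ sumFrom1 n g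
sumFrom1-cong zero    f≗g = refl
sumFrom1-cong (suc n) f≗g =
  cong₂ _+_ (sumFrom1-cong n (λ j 1≤j j≤n → f≗g j 1≤j (m≤n⇒m≤1+n j≤n)))
            (f≗g (suc n) (s≤s z≤n) ≤-refl)

sumFrom1-zero : ∀ n {f : ℕ → ℕ} → (∀ j → 1 ≤ j → j ≤ n → f j ≡ 0) → sumFrom1 n f ≡ 0
sumFrom1-zero zero    f≗0 = refl
sumFrom1-zero (suc n) f≗0 =
  cong₂ _+_ (sumFrom1-zero n (λ j 1≤j j≤n → f≗0 j 1≤j (m≤n⇒m≤1+n j≤n)))
            (f≗0 (suc n) (s≤s z≤n) ≤-refl)

sumFrom1-suc : ∀ n (g : ℕ → ℕ) → sumFrom1 (suc n) g ≡ g 1 + sumFrom1 n (λ j → g (suc j))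
sumFrom1-suc zero    g = sym (+-identityʳ (g 1))
sumFrom1-suc (suc n) g = begin
  sumFrom1 (suc n) g + g (suc (suc n))                  ≡⟨ cong (_+ g (suc (suc n))) (sumFrom1-suc n g) ⟩
  g 1 + sumFrom1 n (λ j → g (suc j)) + g (suc (suc n))  ≡⟨ +-assoc (g 1) _ _ ⟩
  g 1 + sumFrom1 (suc n) (λ j → g (suc j))              ∎
  where open ≡-Reasoning

2*m≡m+m : ∀ m → 2 * m ≡ m + m
2*m≡m+m m = cong (m +_) (+-identityʳ m)

<ᵇ-true : ∀ {m n} → m < n → (m <ᵇ n) ≡ true
<ᵇ-true m<n = to T-≡ (<⇒<ᵇ m<n)

<ᵇ-false : ∀ {m n} → n ≤ m → (m <ᵇ n) ≡ false
<ᵇ-false {m} {n} n≤m = ¬-not (λ m<ᵇn → ≤⇒≯ n≤m (<ᵇ⇒< m n (from T-≡ m<ᵇn)))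

≡ᵇ-refl : ∀ n → (n ≡ᵇ n) ≡ true
≡ᵇ-refl n = to T-≡ (≡⇒≡ᵇ n n refl)

≡ᵇ-false : ∀ {m n} → m ≢ n → (m ≡ᵇ n) ≡ false
≡ᵇ-false {m} {n} m≢n = ¬-not (λ m≡ᵇn → m≢n (≡ᵇ⇒≡ m n (from T-≡ m≡ᵇn)))

Ffuel-below : ∀ {fuel n k} → k < n → Ffuel (suc fuel) n k ≡ 0
Ffuel-below k<n rewrite <ᵇ-true k<n = refl

Ffuel-diag : ∀ {fuel} n → Ffuel (suc fuel) n n ≡ 1
Ffuel-diag n rewrite <ᵇ-false (≤-refl {n}) | ≡ᵇ-refl n = refl

Ffuel-above : ∀ {fuel n k} → n < k →
              Ffuel (suc fuel) n k ≡ sumFrom1 n (λ j → Ffuel fuel n (k ∸ j))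
Ffuel-above n<k rewrite <ᵇ-false (<⇒≤ n<k) | ≡ᵇ-false (>⇒≢ n<k) = refl

Ffuel-fuel-irrelevant : ∀ {f g} n m → 1 ≤ m → m ≤ f → m ≤ g → Ffuel f n m ≡ Ffuel g n m
Ffuel-fuel-irrelevant {zero}          n (suc m) (s≤s z≤n) () _
Ffuel-fuel-irrelevant {suc f} {zero}  n (suc m) (s≤s z≤n) _ ()
Ffuel-fuel-irrelevant {suc f} {suc g} n m _ m≤f m≤g with <-cmp m n
... | tri< m<n _ _  = trans (Ffuel-below {f} m<n) (sym (Ffuel-below {g} m<n))
... | tri≈ _ refl _ = trans (Ffuel-diag {f} m) (sym (Ffuel-diag {g} m))
... | tri> _ _ n<m  = trans (Ffuel-above {f} n<m) (trans (sumFrom1-cong n same) (sym (Ffuel-above {g} n<m)))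
  where
    same : ∀ j → 1 ≤ j → j ≤ n → Ffuel f n (m ∸ j) ≡ Ffuel g n (m ∸ j)
    same j 1≤j j≤n = Ffuel-fuel-irrelevant {f} {g} n (m ∸ j) (m<n⇒0<n∸m (≤-<-trans j≤n n<m))
                                                   (∸-mono m≤f 1≤j) (∸-mono m≤g 1≤j)

F-below : ∀ {n k} → k < n → F n k ≡ 0
F-below {k = zero}  _   = refl
F-below {k = suc k} k<n = Ffuel-below {k} k<n

F-diag : ∀ n → F (suc n) (suc n) ≡ 1
F-diag n = Ffuel-diag {n} (suc n)

F-rec : ∀ {n k} → n < k → F n k ≡ sumFrom1 n (λ j → F n (k ∸ j))
F-rec {n} {suc k} n<k = trans (Ffuel-above {k} n<k) (sumFrom1-cong n enough-fuel)
  where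
    enough-fuel : ∀ j → 1 ≤ j → j ≤ n → Ffuel k n (suc k ∸ j) ≡ F n (suc k ∸ j)
    enough-fuel j 1≤j j≤n = Ffuel-fuel-irrelevant n (suc k ∸ j) (m<n⇒0<n∸m (≤-<-trans j≤n n<k))
                                                  (∸-mono (≤-refl {suc k}) 1≤j) ≤-refl

sharedTerms : ℕ → ℕ → ℕ
sharedTerms n k = sumFrom1 n (λ j → F (suc n) (k ∸ j))

F-suc : ∀ {n k} → suc n ≤ k → F (suc n) (suc k) ≡ F (suc n) k + sharedTerms n k
F-suc {n} {k} N≤k = trans (F-rec (s≤s N≤k)) (sumFrom1-suc n (λ j → F (suc n) (suc k ∸ j)))

F-sharedTerms : ∀ {n k} → suc n < k → F (suc n) k ≡ sharedTerms n k + F (suc n) (k ∸ suc n)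
F-sharedTerms = F-rec

sharedTerms-diag : ∀ n → sharedTerms n (suc n) ≡ 0
sharedTerms-diag n = sumFrom1-zero n below
  where
    below : ∀ j → 1 ≤ j → j ≤ n → F (suc n) (suc n ∸ j) ≡ 0
    below (suc j) _ _ = F-below (s≤s (m∸n≤m n j))

F-nondecreasing : ∀ {n k} → suc n ≤ k → F (suc n) k ≤ F (suc n) (suc k)
F-nondecreasing N≤k = ≤-trans (m≤m+n _ _) (≤-reflexive (sym (F-suc N≤k)))

F-positive : ∀ {n k} → suc n ≤′ k → 1 ≤ F (suc n) k
F-positive {n} ≤′-refl        = ≤-reflexive (sym (F-diag n))
F-positive     (≤′-step N≤′k) = ≤-trans (F-positive N≤′k) (F-nondecreasing (≤′⇒≤ N≤′k))

sharedTerms-≤ : ∀ {n k} → suc n ≤ k → sharedTerms n k ≤ F (suc n) k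
sharedTerms-≤ {n} N≤k with m≤n⇒m<n∨m≡n N≤k
... | inj₂ refl = ≤-trans (≤-reflexive (sharedTerms-diag n)) z≤n
... | inj₁ N<k  = ≤-trans (m≤m+n _ _) (≤-reflexive (sym (F-sharedTerms N<k)))

sharedTerms-< : ∀ {n k} → 2 * suc n ≤ k → sharedTerms n k < F (suc n) k
sharedTerms-< {n} {k} 2N≤k = begin-strict
  sharedTerms n k                              <⟨ m<m+n _ (F-positive (≤⇒≤′ N≤k∸N)) ⟩
  sharedTerms n k + F (suc n) (k ∸ suc n)      ≡⟨ sym (F-sharedTerms N<k) ⟩
  F (suc n) k                                  ∎
  where
    open ≤-Reasoning
    N+N≤k : suc n + suc n ≤ k
    N+N≤k = subst (_≤ k) (2*m≡m+m (suc n)) 2N≤k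
    N≤k∸N : suc n ≤ k ∸ suc n
    N≤k∸N = m+n≤o⇒m≤o∸n (suc n) N+N≤k
    N<k : suc n < k
    N<k = <-≤-trans (m<m+n (suc n) (s≤s z≤n)) N+N≤k

mainTheorem16 : ∀ (n k : ℕ) → 1 ≤ n → n ≤ k →
    (F n (suc k) ≤ 2 * F n k) × (2 * n ≤ k → F n (suc k) < 2 * F n k)
mainTheorem16 (suc n) k _ N≤k = bound , strictBound
  where
    open ≤-Reasoning
    bound : F (suc n) (suc k) ≤ 2 * F (suc n) k
    bound = begin
      F (suc n) (suc k)                  ≡⟨ F-suc N≤k ⟩
      F (suc n) k + sharedTerms n k      ≤⟨ +-monoʳ-≤ (F (suc n) k) (sharedTerms-≤ N≤k) ⟩
      F (suc n) k + F (suc n) k          ≡⟨ sym (2*m≡m+m (F (suc n) k)) ⟩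
      2 * F (suc n) k                    ∎
    strictBound : 2 * suc n ≤ k → F (suc n) (suc k) < 2 * F (suc n) k
    strictBound 2N≤k = begin-strict
      F (suc n) (suc k)                  ≡⟨ F-suc N≤k ⟩
      F (suc n) k + sharedTerms n k      <⟨ +-monoʳ-< (F (suc n) k) (sharedTerms-< 2N≤k) ⟩
      F (suc n) k + F (suc n) k          ≡⟨ sym (2*m≡m+m (F (suc n) k)) ⟩
      2 * F (suc n) k                    ∎
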